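{- Let $P_A$, $P_B$ be permutation matrices over $\langle 0:n\mid 0:n\rangle$. Then $P_A$ is below $P_B$ in the Bruhat order if and only if $P_A^R\boxdot P_B=\mathit{Id}^R$.
   Context: For integers $i\le j$, $[i:j]=\{i,\dots,j\}$ and $\langle i:j\rangle=\{i+\tfrac12,\dots,j-\tfrac12\}$. For a matrix $D$ over $\langle 0:n\mid 0:n\rangle$, its distribution matrix is $D^\Sigma(i,j)=\sum_{\hat\imath\in\langle i:n\rangle,\hat\jmath\in\langle 0:j\rangle}D(\hat\imath,\hat\jmath)$, $i,j\in[0:n]$. For permutation matrices $P,Q$ over $\langle 0:n\mid 0:n\rangle$, the implicit distance product $P\boxdot Q$ is the permutation matrix $R$ over $\langle 0:n\mid 0:n\rangle$ with $R^\Sigma=P^\Sigma\odot Q^\Sigma$, where $(X\odot Y)(i,k)=\min_{j\in[0:n]}(X(i,j)+Y(j,k))$ (such $R$ exists and is unique). $A^R$ denotes the counterclockwise 90-degree rotation: $A^R(\hat\imath,\hat\jmath)=A(\hat\jmath,n-\hat\imath)$. $\mathit{Id}$ is the identity permutation matrix ($\mathit{Id}(\hat\imath,\hat\jmath)=1$ iff $\hat\imath=\hat\jmath$). $P_A$ is below $P_B$ in the Bruhat order if $P_A$ can be transformed into $P_B$ by a (possibly empty) finite sequence of steps, each of which takes rows $\hat\imath<\hat\imath'$ and columns $\hat\jmath<\hat\jmath'$ where the $2\times 2$ submatrix on these rows and columns is $\begin{pmatrix}1&0\\0&1\end{pmatrix}$ and replaces it by $\begin{pmatrix}0&1\\1&0\end{pmatrix}$.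 -}

module Defs where

open import Data.Nat using (ℕ; zero; suc; _+_; _≤_; _<_; _⊓_)
open import Data.Nat.Properties using (_≤?_; _<?_)
open import Data.Fin using (Fin; toℕ; opposite; _≟_)
import Data.Fin as F
open import Data.Product using (Σ; _×_; _,_)
open import Data.Sum using (_⊎_)
open import Relation.Nullary using (yes; no; ¬_)
open import Relation.Binary.PropositionalEquality using (_≡_)

-- Half-integer index k + 1/2 ∈ ⟨0:n⟩ is represented by k : Fin n.
-- Integer index i ∈ [0:n] is represented by i : Fin (suc n).
Mat : ℕ → Set
Mat n = Fin n → Fin n → ℕ

sumFin : {n : ℕ} → (Fin n → ℕ) → ℕ
sumFin {zero}  f = 0
sumFin {suc n} f = f F.zero + sumFin (λ k → f (F.suc k))

minFin : {n : ℕ} → (Fin (suc n) → ℕ) → ℕ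
minFin {zero}  f = f F.zero
minFin {suc n} f = f F.zero ⊓ minFin (λ k → f (F.suc k))

IsPerm : {n : ℕ} → Mat n → Set
IsPerm {n} A =
  ((i j : Fin n) → (A i j ≡ 0) ⊎ (A i j ≡ 1)) ×
  ((i : Fin n) → sumFin (λ j → A i j) ≡ 1) ×
  ((j : Fin n) → sumFin (λ i → A i j) ≡ 1)

-- distribution matrix over [0:n] × [0:n]:
-- D^Σ(i,j) = Σ_{î ∈ ⟨i:n⟩, ĵ ∈ ⟨0:j⟩} D(î,ĵ)
dist : {n : ℕ} → Mat n → Fin (suc n) → Fin (suc n) → ℕ
dist {n} D i j = sumFin (λ k → sumFin (λ l → sel k l))
  where
  sel : Fin n → Fin n → ℕ
  sel k l with toℕ i ≤? toℕ k | toℕ l <? toℕ j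
  ... | yes _ | yes _ = D k l
  ... | _     | _     = 0

_⊙_ : {n : ℕ} → (Fin (suc n) → Fin (suc n) → ℕ) → (Fin (suc n) → Fin (suc n) → ℕ)
      → Fin (suc n) → Fin (suc n) → ℕ
(X ⊙ Y) i k = minFin (λ j → X i j + Y j k)

-- R = P ⊡ Q : R is a permutation matrix with R^Σ = P^Σ ⊙ Q^Σ
-- (R is unique when it exists, so this relation is the product).
IsBoxProd : {n : ℕ} → Mat n → Mat n → Mat n → Set
IsBoxProd {n} P Q R =
  IsPerm R × ((i k : Fin (suc n)) → dist R i k ≡ (dist P ⊙ dist Q) i k)

-- counterclockwise rotation: A^R(î,ĵ) = A(ĵ, n − î);
-- with î = k + 1/2, n − î = (n−1−k) + 1/2, i.e. opposite k.
rot : {n : ℕ} → Mat n → Mat n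
rot A k l = A l (opposite k)

Id : {n : ℕ} → Mat n
Id k l with k ≟ l
... | yes _ = 1
... | no  _ = 0

Step : {n : ℕ} → Mat n → Mat n → Set
Step {n} A B =
  Σ (Fin n) λ i → Σ (Fin n) λ i' → Σ (Fin n) λ j → Σ (Fin n) λ j' →
    (toℕ i < toℕ i') × (toℕ j < toℕ j') ×
    (A i j ≡ 1) × (A i j' ≡ 0) × (A i' j ≡ 0) × (A i' j' ≡ 1) ×
    (B i j ≡ 0) × (B i j' ≡ 1) × (B i' j ≡ 1) × (B i' j' ≡ 0) ×
    ((k l : Fin n) → ¬ ((k ≡ i ⊎ k ≡ i') × (l ≡ j ⊎ l ≡ j')) → B k l ≡ A k l)

data BruhatBelow {n : ℕ} : Mat n → Mat n → Set where
  done : {A B : Mat n} → ((k l : Fin n) → A k l ≡ B k l) → BruhatBelow A B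
  step : {A C B : Mat n} → Step A C → BruhatBelow C B → BruhatBelow A B

-- Both conditions amount to a dominance of corner counts. Write N_A(J,K) for the number of ones of A
-- in rows < J and columns < K. Then (P_A^R)^Σ(i,j) = N_A(j, n−i) and P_B^Σ(j,k) = k − N_B(j,k), so the
-- (min,+) product at (i,k) is min_j (N_A(j, n−i) + k − N_B(j,k)). The choices j = 0 and j = n bound it by
-- min(k, n−i) = (Id^R)^Σ(i,k), and this bound is attained for all (i,k) exactly when N_B ≤ N_A.
--
-- A Bruhat step subtracts from N the indicator function of a rectangle, so P_A below P_B gives N_B ≤ N_A.
-- Conversely, let N_B ≤ N_A with P_A ≠ P_B, and let i be the first row where they differ, with ones in
-- columns σ_A(i) and σ_B(i). Dominance on rows ≤ i and columns ≤ σ_B(i) forces σ_A(i) < σ_B(i).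
-- Swapping row i with the first later row i' whose one lies in (σ_A(i), σ_B(i)] is a step, and it lowers
-- N only on a rectangle where N_B < N_A, as comparison with column σ_B(i) shows. So dominance survives,
-- Σ N decreases, and iterating reaches P_B.

module Submission where

open import Defs
open import Data.Bool using (true; false)
open import Data.Nat using (ℕ; zero; suc; _+_; _*_; _∸_; _≤_; _<_; _⊓_; z≤n; s≤s)
open import Data.Nat.Properties hiding (_≟_)
open import Data.Nat.Tactic.RingSolver using (solve-∀)
open import Algebra.Properties.Semiring.Sum +-*-semiring using (sum; ∑-distrib-+; ∑-comm; *-distribˡ-sum)
open import Algebra.Properties.CommutativeSemigroup *-commutativeSemigroup using (x∙yz≈y∙xz)
open import Data.Fin using (Fin; toℕ; opposite; _≟_; fromℕ<; fromℕ)
import Data.Fin as F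
import Data.Fin.Properties as FP
open import Data.Fin.Permutation.Components using (transpose; transpose-inverse)
open import Data.Product using (Σ; _×_; _,_; proj₁; proj₂)
open import Data.Sum using (_⊎_; inj₁; inj₂) renaming (map to map⊎)
open import Data.Empty using (⊥-elim)
open import Function.Base using (_∘_)
open import Function.Bundles using (_⇔_; mk⇔)
open import Relation.Nullary using (Dec; yes; no; _because_; ¬_; ¬?)
open import Relation.Nullary.Decidable using (_×-dec_; dec-true; dec-false; decidable-stable)
open import Relation.Binary.Definitions using (tri<; tri≈; tri>)
open import Relation.Binary.PropositionalEquality hiding (J)

-- Iverson brackets and finite sums

𝟙 : {P : Set} → Dec P → ℕ
𝟙 (true  because _) = 1
𝟙 (false because _) = 0

𝟙-yes : {P : Set} (d : Dec P) → P → 𝟙 d ≡ 1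
𝟙-yes (yes _) _ = refl
𝟙-yes (no ¬p) p = ⊥-elim (¬p p)

𝟙-no : {P : Set} (d : Dec P) → ¬ P → 𝟙 d ≡ 0
𝟙-no (yes p) ¬p = ⊥-elim (¬p p)
𝟙-no (no _)  _  = refl

𝟙-mono : {P Q : Set} (d : Dec P) (e : Dec Q) → (P → Q) → 𝟙 d ≤ 𝟙 e
𝟙-mono (yes p) e       P⇒Q = ≤-reflexive (sym (𝟙-yes e (P⇒Q p)))
𝟙-mono (no _)  _       _   = z≤n

𝟙-cong : {P Q : Set} (d : Dec P) (e : Dec Q) → (P → Q) → (Q → P) → 𝟙 d ≡ 𝟙 e
𝟙-cong d e P⇒Q Q⇒P = ≤-antisym (𝟙-mono d e P⇒Q) (𝟙-mono e d Q⇒P)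

𝟙-complement : {P Q : Set} (d : Dec P) (e : Dec Q) → (P → ¬ Q) → (¬ P → Q) → 𝟙 d + 𝟙 e ≡ 1
𝟙-complement (yes p) e  P⇒¬Q _   = cong suc (𝟙-no e (P⇒¬Q p))
𝟙-complement (no ¬p) e  _    ¬P⇒Q = 𝟙-yes e (¬P⇒Q ¬p)

𝟙-× : {P Q R : Set} (d : Dec P) (e : Dec Q) (f : Dec R) → (P → Q → R) → (R → P × Q) → 𝟙 d * 𝟙 e ≡ 𝟙 f
𝟙-× (yes p) (yes q) f PQ⇒R _ = sym (𝟙-yes f (PQ⇒R p q))
𝟙-× (yes _) (no ¬q) f _ R⇒PQ = sym (𝟙-no f (¬q ∘ proj₂ ∘ R⇒PQ))
𝟙-× (no ¬p) _       f _ R⇒PQ = sym (𝟙-no f (¬p ∘ proj₁ ∘ R⇒PQ))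

⟦_<_⟧ ⟦_≤_⟧ : ℕ → ℕ → ℕ
⟦ a < b ⟧ = 𝟙 (a <? b)
⟦ a ≤ b ⟧ = 𝟙 (a ≤? b)

⟦<⟧-yes : ∀ {a b} → a < b → ⟦ a < b ⟧ ≡ 1
⟦<⟧-yes {a} {b} = 𝟙-yes (a <? b)

⟦<⟧-no : ∀ {a b} → ¬ a < b → ⟦ a < b ⟧ ≡ 0
⟦<⟧-no {a} {b} = 𝟙-no (a <? b)

⟦≤⟧-no : ∀ {a b} → ¬ a ≤ b → ⟦ a ≤ b ⟧ ≡ 0
⟦≤⟧-no {a} {b} = 𝟙-no (a ≤? b)

⟦<⟧+⟦≥⟧ : ∀ a b → ⟦ a < b ⟧ + ⟦ b ≤ a ⟧ ≡ 1
⟦<⟧+⟦≥⟧ a b = 𝟙-complement (a <? b) (b ≤? a) <⇒≱ ≮⇒≥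

⟦<⟧-monoʳ : ∀ a {b c} → b ≤ c → ⟦ a < b ⟧ ≤ ⟦ a < c ⟧
⟦<⟧-monoʳ a {b} {c} b≤c = 𝟙-mono (a <? b) (a <? c) (λ a<b → <-≤-trans a<b b≤c)

⟦<⟧-antiˡ : ∀ {a a'} J → a < a' → ⟦ a' < J ⟧ ≤ ⟦ a < J ⟧
⟦<⟧-antiˡ {a} {a'} J a<a' = 𝟙-mono (a' <? J) (a <? J) (<-trans a<a')

⟦<⟧-⊓ : ∀ a b c → ⟦ a < b ⟧ * ⟦ a < c ⟧ ≡ ⟦ a < b ⊓ c ⟧
⟦<⟧-⊓ a b c = 𝟙-× (a <? b) (a <? c) (a <? b ⊓ c) ⊓-glb
  (λ a<b⊓c → m<n⊓o⇒m<n b c a<b⊓c , m<n⊓o⇒m<o b c a<b⊓c)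

sumFin-cong : ∀ {n} {f g : Fin n → ℕ} → (∀ k → f k ≡ g k) → sumFin f ≡ sumFin g
sumFin-cong {zero}  f≗g = refl
sumFin-cong {suc n} f≗g = cong₂ _+_ (f≗g F.zero) (sumFin-cong (f≗g ∘ F.suc))

sumFin≡sum : ∀ {n} (f : Fin n → ℕ) → sumFin f ≡ sum f
sumFin≡sum {zero}  f = refl
sumFin≡sum {suc n} f = cong (f F.zero +_) (sumFin≡sum (f ∘ F.suc))

sumFin-+ : ∀ {n} (f g : Fin n → ℕ) → sumFin (λ k → f k + g k) ≡ sumFin f + sumFin g
sumFin-+ f g = begin
  sumFin (λ k → f k + g k)  ≡⟨ sumFin≡sum (λ k → f k + g k) ⟩
  sum (λ k → f k + g k)     ≡⟨ ∑-distrib-+ f g ⟩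
  sum f + sum g             ≡⟨ sym (cong₂ _+_ (sumFin≡sum f) (sumFin≡sum g)) ⟩
  sumFin f + sumFin g       ∎
  where open ≡-Reasoning

sumFin-*ˡ : ∀ {n} c (f : Fin n → ℕ) → sumFin (λ k → c * f k) ≡ c * sumFin f
sumFin-*ˡ c f = begin
  sumFin (λ k → c * f k)  ≡⟨ sumFin≡sum (λ k → c * f k) ⟩
  sum (λ k → c * f k)     ≡⟨ sym (*-distribˡ-sum c f) ⟩
  c * sum f               ≡⟨ cong (c *_) (sym (sumFin≡sum f)) ⟩
  c * sumFin f            ∎
  where open ≡-Reasoning

sumFin-comm : ∀ {m n} (f : Fin m → Fin n → ℕ) →
              sumFin (λ k → sumFin (f k)) ≡ sumFin (λ l → sumFin (λ k → f k l))
sumFin-comm f = trans (sumFin²≡sum² f) (trans (∑-comm f) (sym (sumFin²≡sum² (λ l k → f k l))))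
  where
  sumFin²≡sum² : ∀ {m n} (g : Fin m → Fin n → ℕ) →
                 sumFin (λ k → sumFin (g k)) ≡ sum (λ k → sum (g k))
  sumFin²≡sum² g = trans (sumFin-cong (λ k → sumFin≡sum (g k))) (sumFin≡sum (λ k → sum (g k)))

sumFin-zero : ∀ {n} {f : Fin n → ℕ} → (∀ k → f k ≡ 0) → sumFin f ≡ 0
sumFin-zero {zero}  f≗0 = refl
sumFin-zero {suc n} f≗0 = cong₂ _+_ (f≗0 F.zero) (sumFin-zero (f≗0 ∘ F.suc))

sumFin≡0⇒≡0 : ∀ {n} (f : Fin n → ℕ) → sumFin f ≡ 0 → ∀ k → f k ≡ 0
sumFin≡0⇒≡0 f Σf≡0 F.zero    = m+n≡0⇒m≡0 (f F.zero) Σf≡0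
sumFin≡0⇒≡0 f Σf≡0 (F.suc k) = sumFin≡0⇒≡0 (f ∘ F.suc) (m+n≡0⇒n≡0 (f F.zero) Σf≡0) k

sumFin-mono : ∀ {n} {f g : Fin n → ℕ} → (∀ k → f k ≤ g k) → sumFin f ≤ sumFin g
sumFin-mono {zero}  f≤g = z≤n
sumFin-mono {suc n} f≤g = +-mono-≤ (f≤g F.zero) (sumFin-mono (f≤g ∘ F.suc))

sumFin-mono-< : ∀ {n} {f g : Fin n → ℕ} → (∀ k → f k ≤ g k) → ∀ p → f p < g p → sumFin f < sumFin g
sumFin-mono-< f≤g F.zero    fp<gp = +-mono-<-≤ fp<gp (sumFin-mono (f≤g ∘ F.suc))
sumFin-mono-< f≤g (F.suc p) fp<gp = +-mono-≤-< (f≤g F.zero) (sumFin-mono-< (f≤g ∘ F.suc) p fp<gp)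

sumFin-*-indicator : ∀ {n} (h : Fin n → ℕ) (p : Fin n) → h p ≡ 1 → (∀ c → c ≢ p → h c ≡ 0) →
                     (g : Fin n → ℕ) → sumFin (λ c → g c * h c) ≡ g p
sumFin-*-indicator {suc n} h F.zero hp≡1 h≡0 g = trans
  (cong₂ _+_ (trans (cong (g F.zero *_) hp≡1) (*-identityʳ (g F.zero)))
             (sumFin-zero (λ c → trans (cong (g (F.suc c) *_) (h≡0 (F.suc c) (λ ()))) (*-zeroʳ (g (F.suc c))))))
  (+-identityʳ (g F.zero))
sumFin-*-indicator {suc n} h (F.suc p) hp≡1 h≡0 g = trans
  (cong (_+ sumFin (λ c → g (F.suc c) * h (F.suc c)))
        (trans (cong (g F.zero *_) (h≡0 F.zero (λ ()))) (*-zeroʳ (g F.zero))))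
  (sumFin-*-indicator (h ∘ F.suc) p hp≡1 (λ c c≢p → h≡0 (F.suc c) (c≢p ∘ FP.suc-injective)) (g ∘ F.suc))

minFin-≤ : ∀ {n} (f : Fin (suc n) → ℕ) j → minFin f ≤ f j
minFin-≤ {zero}  f F.zero    = ≤-refl
minFin-≤ {suc n} f F.zero    = m⊓n≤m _ _
minFin-≤ {suc n} f (F.suc j) = ≤-trans (m⊓n≤n _ _) (minFin-≤ (f ∘ F.suc) j)

minFin-glb : ∀ {n} (f : Fin (suc n) → ℕ) v → (∀ j → v ≤ f j) → v ≤ minFin f
minFin-glb {zero}  f v v≤f = v≤f F.zero
minFin-glb {suc n} f v v≤f = ⊓-glb (v≤f F.zero) (minFin-glb (f ∘ F.suc) v (v≤f ∘ F.suc))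

-- Permutation matrices

Id-≡ : ∀ {n} {p c : Fin n} → p ≡ c → Id p c ≡ 1
Id-≡ {p = p} {c} p≡c with p ≟ c
... | yes _   = refl
... | no  p≢c = ⊥-elim (p≢c p≡c)

Id-≢ : ∀ {n} {p c : Fin n} → p ≢ c → Id p c ≡ 0
Id-≢ {p = p} {c} p≢c with p ≟ c
... | yes p≡c = ⊥-elim (p≢c p≡c)
... | no _    = refl

Id≡1⇒≡ : ∀ {n} {p c : Fin n} → Id p c ≡ 1 → p ≡ c
Id≡1⇒≡ {p = p} {c} Id≡1 with p ≟ c | Id≡1
... | yes p≡c | _  = p≡c
... | no _    | ()

Id-0∨1 : ∀ {n} (p c : Fin n) → (Id p c ≡ 0) ⊎ (Id p c ≡ 1)
Id-0∨1 p c with p ≟ c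
... | yes _ = inj₂ refl
... | no _  = inj₁ refl

Id-inverse : ∀ {n} (f g : Fin n → Fin n) → (∀ x → f (g x) ≡ x) → (∀ x → g (f x) ≡ x) →
             ∀ q r → Id q (f r) ≡ Id (g q) r
Id-inverse f g fg gf q r = by (q ≟ f r)
  where
  by : Dec (q ≡ f r) → Id q (f r) ≡ Id (g q) r
  by (yes q≡fr) = trans (Id-≡ q≡fr) (sym (Id-≡ (trans (cong g q≡fr) (gf r))))
  by (no q≢fr)  = trans (Id-≢ q≢fr) (sym (Id-≢ (λ gq≡r → q≢fr (trans (sym (fg q)) (cong f gq≡r)))))

Id-sym : ∀ {n} (p c : Fin n) → Id p c ≡ Id c p
Id-sym p c = by (p ≟ c)
  where
  by : Dec (p ≡ c) → Id p c ≡ Id c p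
  by (yes p≡c) = trans (Id-≡ p≡c) (sym (Id-≡ (sym p≡c)))
  by (no p≢c)  = trans (Id-≢ p≢c) (sym (Id-≢ (p≢c ∘ sym)))

Id-suc : ∀ {n} (p c : Fin n) → Id (F.suc p) (F.suc c) ≡ Id p c
Id-suc p c = by (p ≟ c)
  where
  by : Dec (p ≡ c) → Id (F.suc p) (F.suc c) ≡ Id p c
  by (yes p≡c) = trans (Id-≡ (cong F.suc p≡c)) (sym (Id-≡ p≡c))
  by (no p≢c)  = trans (Id-≢ (p≢c ∘ FP.suc-injective)) (sym (Id-≢ p≢c))

Id-opposite : ∀ {n} (p k : Fin n) → Id p (opposite k) ≡ Id (opposite p) k
Id-opposite = Id-inverse opposite opposite FP.opposite-involutive FP.opposite-involutive

sumFin-*-Id : ∀ {n} (p : Fin n) (g : Fin n → ℕ) → sumFin (λ c → g c * Id p c) ≡ g p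
sumFin-*-Id p = sumFin-*-indicator (Id p) p (Id-≡ refl) (λ c c≢p → Id-≢ (c≢p ∘ sym))

sumFin-Id : ∀ {n} (p : Fin n) → sumFin (Id p) ≡ 1
sumFin-Id p = trans (sumFin-cong (λ c → sym (*-identityˡ (Id p c)))) (sumFin-*-Id p (λ _ → 1))

unitVector : ∀ {n} (f : Fin n → ℕ) → (∀ c → (f c ≡ 0) ⊎ (f c ≡ 1)) → sumFin f ≡ 1 →
             Σ (Fin n) λ p → ∀ c → f c ≡ Id p c
unitVector {suc n} f f01 Σf≡1 with f01 F.zero
... | inj₂ f₀≡1 = F.zero , λ where
      F.zero    → trans f₀≡1 (sym (Id-≡ {p = F.zero {n}} refl))
      (F.suc c) → trans (sumFin≡0⇒≡0 (f ∘ F.suc) rest≡0 c) (sym (Id-≢ {p = F.zero} {F.suc c} (λ ())))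
  where
  rest≡0 : sumFin (f ∘ F.suc) ≡ 0
  rest≡0 = +-cancelˡ-≡ 1 _ 0 (trans (cong (_+ sumFin (f ∘ F.suc)) (sym f₀≡1)) Σf≡1)
... | inj₁ f₀≡0
  with unitVector (f ∘ F.suc) (f01 ∘ F.suc) (trans (cong (_+ sumFin (f ∘ F.suc)) (sym f₀≡0)) Σf≡1)
...   | p , f≗Id = F.suc p , λ where
      F.zero    → trans f₀≡0 (sym (Id-≢ {p = F.suc p} {F.zero} (λ ())))
      (F.suc c) → trans (f≗Id c) (sym (Id-suc p c))

record PermutationMatrix {n : ℕ} (A : Mat n) : Set where
  field
    σ   : Fin n → Fin n
    τ   : Fin n → Fin n
    row : ∀ l c → A l c ≡ Id (σ l) c
    col : ∀ r c → A r c ≡ Id (τ c) r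

  τ-σ : ∀ l → τ (σ l) ≡ l
  τ-σ l = Id≡1⇒≡ (trans (sym (col l (σ l))) (trans (row l (σ l)) (Id-≡ refl)))

  σ-τ : ∀ c → σ (τ c) ≡ c
  σ-τ c = Id≡1⇒≡ (trans (sym (row (τ c) c)) (trans (col (τ c) c) (Id-≡ refl)))

  σ-injective : ∀ a b → σ a ≡ σ b → a ≡ b
  σ-injective a b σa≡σb = trans (sym (τ-σ a)) (trans (cong τ σa≡σb) (τ-σ b))

  columnSum : ∀ c → sumFin (λ r → A r c) ≡ 1
  columnSum c = trans (sumFin-cong (λ r → col r c)) (sumFin-Id (τ c))

isPerm⇒permutationMatrix : ∀ {n} {A : Mat n} → IsPerm A → PermutationMatrix A
isPerm⇒permutationMatrix {A = A} (A01 , rowSum , colSum) = record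
  { σ   = λ l → proj₁ (rows l)
  ; τ   = λ c → proj₁ (cols c)
  ; row = λ l → proj₂ (rows l)
  ; col = λ r c → proj₂ (cols c) r
  }
  where
  rows : ∀ l → Σ _ λ p → ∀ c → A l c ≡ Id p c
  rows l = unitVector (A l) (A01 l) (rowSum l)
  cols : ∀ c → Σ _ λ q → ∀ r → A r c ≡ Id q r
  cols c = unitVector (λ r → A r c) (λ r → A01 r c) (colSum c)

Id-permutationMatrix : ∀ {n} → PermutationMatrix (Id {n})
Id-permutationMatrix = record { σ = λ l → l ; τ = λ c → c ; row = λ _ _ → refl ; col = Id-sym }

rot-Id-isPerm : ∀ {n} → IsPerm (rot (Id {n}))
rot-Id-isPerm =
  (λ k l → Id-0∨1 l (opposite k)) ,
  (λ k → trans (sumFin-cong (λ l → Id-sym l (opposite k))) (sumFin-Id (opposite k))) ,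
  (λ l → trans (sumFin-cong (Id-opposite l)) (sumFin-Id (opposite l)))

-- Corner counts and distribution matrices

rowCount : ∀ {n} → Mat n → Fin n → ℕ → ℕ
rowCount A l K = sumFin (λ c → ⟦ toℕ c < K ⟧ * A l c)

cornerNW cornerSW : ∀ {n} → Mat n → ℕ → ℕ → ℕ
cornerNW A J K = sumFin (λ l → ⟦ toℕ l < J ⟧ * rowCount A l K)
cornerSW A J K = sumFin (λ l → ⟦ J ≤ toℕ l ⟧ * rowCount A l K)

rowCount-Id : ∀ {n} (A : Mat n) l p → (∀ c → A l c ≡ Id p c) → ∀ K → rowCount A l K ≡ ⟦ toℕ p < K ⟧
rowCount-Id A l p Al≗Id K =
  trans (sumFin-cong (λ c → cong (⟦ toℕ c < K ⟧ *_) (Al≗Id c))) (sumFin-*-Id p (λ c → ⟦ toℕ c < K ⟧))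

rowCount-monoʳ : ∀ {n} (A : Mat n) l {K K'} → K ≤ K' → rowCount A l K ≤ rowCount A l K'
rowCount-monoʳ A l K≤K' = sumFin-mono (λ c → *-monoˡ-≤ (A l c) (⟦<⟧-monoʳ (toℕ c) K≤K'))

count-< : ∀ n K → sumFin {n} (λ l → ⟦ toℕ l < K ⟧) ≡ K ⊓ n
count-< zero    K       = sym (⊓-zeroʳ K)
count-< (suc n) zero    = sumFin-zero {suc n} (λ _ → refl)
count-< (suc n) (suc K) =
  cong suc (trans (sumFin-cong {n} (λ l → 𝟙-cong (suc (toℕ l) <? suc K) (toℕ l <? K) ≤-pred s≤s)) (count-< n K))

sumFin-rowCount : ∀ {n} {A : Mat n} → PermutationMatrix A → ∀ K → K ≤ n → sumFin (λ r → rowCount A r K) ≡ K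
sumFin-rowCount {n} {A} pA K K≤n = begin
  sumFin (λ r → rowCount A r K)                        ≡⟨ sumFin-comm {n} {n} (λ r c → ⟦ toℕ c < K ⟧ * A r c) ⟩
  sumFin (λ c → sumFin (λ r → ⟦ toℕ c < K ⟧ * A r c))  ≡⟨ sumFin-cong {n} column ⟩
  sumFin {n} (λ c → ⟦ toℕ c < K ⟧)                     ≡⟨ count-< n K ⟩
  K ⊓ n                                                ≡⟨ m≤n⇒m⊓n≡m K≤n ⟩
  K                                                    ∎
  where
  open ≡-Reasoning
  column : ∀ c → sumFin (λ r → ⟦ toℕ c < K ⟧ * A r c) ≡ ⟦ toℕ c < K ⟧
  column c = trans (sumFin-*ˡ ⟦ toℕ c < K ⟧ (λ r → A r c))
                   (trans (cong (⟦ toℕ c < K ⟧ *_) (PermutationMatrix.columnSum pA c)) (*-identityʳ _))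

cornerNW+cornerSW : ∀ {n} {A : Mat n} → PermutationMatrix A → ∀ J K → K ≤ n → cornerNW A J K + cornerSW A J K ≡ K
cornerNW+cornerSW {A = A} pA J K K≤n =
  trans (sym (sumFin-+ (λ l → ⟦ toℕ l < J ⟧ * rowCount A l K) (λ l → ⟦ J ≤ toℕ l ⟧ * rowCount A l K)))
        (trans (sumFin-cong split) (sumFin-rowCount pA K K≤n))
  where
  split : ∀ l → ⟦ toℕ l < J ⟧ * rowCount A l K + ⟦ J ≤ toℕ l ⟧ * rowCount A l K ≡ rowCount A l K
  split l = trans (sym (*-distribʳ-+ (rowCount A l K) ⟦ toℕ l < J ⟧ ⟦ J ≤ toℕ l ⟧))
                  (trans (cong (_* rowCount A l K) (⟦<⟧+⟦≥⟧ (toℕ l) J)) (*-identityˡ _))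

cornerNW-zero : ∀ {n} (A : Mat n) K → cornerNW A 0 K ≡ 0
cornerNW-zero {n} A K = sumFin-zero {n} (λ _ → refl)

cornerSW-full : ∀ {n} (A : Mat n) K → cornerSW A n K ≡ 0
cornerSW-full A K = sumFin-zero (λ l → cong (_* rowCount A l K) (⟦≤⟧-no (<⇒≱ (FP.toℕ<n l))))

cornerNW-monoʳ : ∀ {n} (A : Mat n) J {K K'} → K ≤ K' → cornerNW A J K ≤ cornerNW A J K'
cornerNW-monoʳ A J K≤K' = sumFin-mono (λ l → *-monoʳ-≤ ⟦ toℕ l < J ⟧ (rowCount-monoʳ A l K≤K'))

cornerSW-monoʳ : ∀ {n} (A : Mat n) J {K K'} → K ≤ K' → cornerSW A J K ≤ cornerSW A J K'
cornerSW-monoʳ A J K≤K' = sumFin-mono (λ l → *-monoʳ-≤ ⟦ J ≤ toℕ l ⟧ (rowCount-monoʳ A l K≤K'))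

dist-as-sum : ∀ {n} (D : Mat n) i j →
  dist D i j ≡ sumFin (λ k → sumFin (λ l → ⟦ toℕ i ≤ toℕ k ⟧ * (⟦ toℕ l < toℕ j ⟧ * D k l)))
dist-as-sum D i j = entries
  where
  -- The left-hand side is the entry selector local to the definition of dist.
  entry : ∀ k l → _ ≡ ⟦ toℕ i ≤ toℕ k ⟧ * (⟦ toℕ l < toℕ j ⟧ * D k l)
  entries : dist D i j ≡ sumFin (λ k → sumFin (λ l → ⟦ toℕ i ≤ toℕ k ⟧ * (⟦ toℕ l < toℕ j ⟧ * D k l)))
  entries = sumFin-cong (λ k → sumFin-cong (λ l → entry k l))
  entry k l with toℕ i ≤? toℕ k | toℕ l <? toℕ j
  ... | yes _ | yes _ = sym (trans (*-identityˡ _) (*-identityˡ _))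
  ... | yes _ | no _  = refl
  ... | no _  | yes _ = refl
  ... | no _  | no _  = refl

dist≡cornerSW : ∀ {n} (B : Mat n) j k → dist B j k ≡ cornerSW B (toℕ j) (toℕ k)
dist≡cornerSW B j k =
  trans (dist-as-sum B j k)
        (sumFin-cong (λ r → sumFin-*ˡ ⟦ toℕ j ≤ toℕ r ⟧ (λ l → ⟦ toℕ l < toℕ k ⟧ * B r l)))

⟦≤opposite⟧ : ∀ {n} (i : Fin (suc n)) (p : Fin n) →
              ⟦ toℕ i ≤ toℕ (opposite p) ⟧ ≡ ⟦ toℕ p < n ∸ toℕ i ⟧
⟦≤opposite⟧ {n} i p rewrite FP.opposite-prop p =
  𝟙-cong (toℕ i ≤? n ∸ suc (toℕ p)) (toℕ p <? n ∸ toℕ i) ⇒ ⇐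
  where
  p<n : suc (toℕ p) ≤ n
  p<n = FP.toℕ<n p
  i≤n : toℕ i ≤ n
  i≤n = FP.toℕ≤pred[n] i
  ⇒ : toℕ i ≤ n ∸ suc (toℕ p) → toℕ p < n ∸ toℕ i
  ⇒ h = m+n≤o⇒m≤o∸n (suc (toℕ p)) (subst (_≤ n) (+-comm (toℕ i) _) (m≤o∸n⇒m+n≤o (toℕ i) p<n h))
  ⇐ : toℕ p < n ∸ toℕ i → toℕ i ≤ n ∸ suc (toℕ p)
  ⇐ h = m+n≤o⇒m≤o∸n (toℕ i) (subst (_≤ n) (+-comm (suc (toℕ p)) _) (m≤o∸n⇒m+n≤o (suc (toℕ p)) i≤n h))

dist-rot : ∀ {n} {A : Mat n} → PermutationMatrix A → ∀ i j → dist (rot A) i j ≡ cornerNW A (toℕ j) (n ∸ toℕ i)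
dist-rot {n} {A} pA i j =
  trans (dist-as-sum (rot A) i j)
        (trans (sumFin-comm (λ k l → ⟦ toℕ i ≤ toℕ k ⟧ * (⟦ toℕ l < toℕ j ⟧ * A l (opposite k))))
               (sumFin-cong row))
  where
  open PermutationMatrix pA using (σ) renaming (row to A≗Id)
  open ≡-Reasoning
  row : ∀ l → sumFin (λ k → ⟦ toℕ i ≤ toℕ k ⟧ * (⟦ toℕ l < toℕ j ⟧ * A l (opposite k)))
              ≡ ⟦ toℕ l < toℕ j ⟧ * rowCount A l (n ∸ toℕ i)
  row l = begin
    sumFin (λ k → ⟦ toℕ i ≤ toℕ k ⟧ * (⟦ toℕ l < toℕ j ⟧ * A l (opposite k)))
      ≡⟨ sumFin-cong (λ k → trans (cong (λ x → ⟦ toℕ i ≤ toℕ k ⟧ * (⟦ toℕ l < toℕ j ⟧ * x))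
                                         (trans (A≗Id l (opposite k)) (Id-opposite (σ l) k)))
                                  (sym (*-assoc ⟦ toℕ i ≤ toℕ k ⟧ _ _))) ⟩
    sumFin (λ k → ⟦ toℕ i ≤ toℕ k ⟧ * ⟦ toℕ l < toℕ j ⟧ * Id (opposite (σ l)) k)
      ≡⟨ sumFin-*-Id (opposite (σ l)) (λ k → ⟦ toℕ i ≤ toℕ k ⟧ * ⟦ toℕ l < toℕ j ⟧) ⟩
    ⟦ toℕ i ≤ toℕ (opposite (σ l)) ⟧ * ⟦ toℕ l < toℕ j ⟧
      ≡⟨ *-comm ⟦ toℕ i ≤ toℕ (opposite (σ l)) ⟧ _ ⟩
    ⟦ toℕ l < toℕ j ⟧ * ⟦ toℕ i ≤ toℕ (opposite (σ l)) ⟧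
      ≡⟨ cong (⟦ toℕ l < toℕ j ⟧ *_) (⟦≤opposite⟧ i (σ l)) ⟩
    ⟦ toℕ l < toℕ j ⟧ * ⟦ toℕ (σ l) < n ∸ toℕ i ⟧
      ≡⟨ cong (⟦ toℕ l < toℕ j ⟧ *_) (sym (rowCount-Id A l (σ l) (A≗Id l) (n ∸ toℕ i))) ⟩
    ⟦ toℕ l < toℕ j ⟧ * rowCount A l (n ∸ toℕ i) ∎

dist-rot-Id : ∀ {n} (i k : Fin (suc n)) → dist (rot (Id {n})) i k ≡ toℕ k ⊓ (n ∸ toℕ i)
dist-rot-Id {n} i k = begin
  dist (rot (Id {n})) i k                     ≡⟨ dist-rot Id-permutationMatrix i k ⟩
  cornerNW (Id {n}) (toℕ k) m                 ≡⟨ sumFin-cong {n} corner ⟩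
  sumFin {n} (λ l → ⟦ toℕ l < toℕ k ⊓ m ⟧)   ≡⟨ count-< n (toℕ k ⊓ m) ⟩
  toℕ k ⊓ m ⊓ n                               ≡⟨ m≤n⇒m⊓n≡m (≤-trans (m⊓n≤m _ _) (FP.toℕ≤pred[n] k)) ⟩
  toℕ k ⊓ m                                   ∎
  where
  open ≡-Reasoning
  m : ℕ
  m = n ∸ toℕ i
  corner : ∀ l → ⟦ toℕ l < toℕ k ⟧ * rowCount Id l m ≡ ⟦ toℕ l < toℕ k ⊓ m ⟧
  corner l = trans (cong (⟦ toℕ l < toℕ k ⟧ *_) (rowCount-Id Id l l (λ _ → refl) m))
                   (⟦<⟧-⊓ (toℕ l) (toℕ k) m)

cornerNW-full : ∀ {n} {A : Mat n} → PermutationMatrix A → ∀ K → K ≤ n → cornerNW A n K ≡ K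
cornerNW-full {n} {A} pA K K≤n =
  trans (sym (+-identityʳ _)) (trans (cong (cornerNW A n K +_) (sym (cornerSW-full A K))) (cornerNW+cornerSW pA n K K≤n))

cornerSW-zero : ∀ {n} {A : Mat n} → PermutationMatrix A → ∀ K → K ≤ n → cornerSW A 0 K ≡ K
cornerSW-zero {A = A} pA K K≤n = trans (cong (_+ cornerSW A 0 K) (sym (cornerNW-zero A K))) (cornerNW+cornerSW pA 0 K K≤n)

n∸opposite : ∀ {n} (k : Fin (suc n)) → n ∸ toℕ (opposite k) ≡ toℕ k
n∸opposite {n} k = trans (cong (n ∸_) (FP.opposite-prop k)) (m∸[m∸n]≡n (FP.toℕ≤pred[n] k))

-- The box product with Id^R

Dominates : ∀ {n} → Mat n → Mat n → Set
Dominates {n} A B = ∀ J K → J ≤ n → K ≤ n → cornerNW B J K ≤ cornerNW A J K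

module _ {n : ℕ} {A B : Mat n} (pA : PermutationMatrix A) (pB : PermutationMatrix B) where

  dist-rot+dist : ∀ i j k →
    dist (rot A) i j + dist B j k ≡ cornerNW A (toℕ j) (n ∸ toℕ i) + cornerSW B (toℕ j) (toℕ k)
  dist-rot+dist i j k = cong₂ _+_ (dist-rot pA i j) (dist≡cornerSW B j k)

  boxProduct⇒dominates : IsBoxProd (rot A) B (rot Id) → Dominates A B
  boxProduct⇒dominates (_ , product) J K J≤n K≤n =
    subst₂ (λ J K → cornerNW B J K ≤ cornerNW A J K) (FP.toℕ-fromℕ< (s≤s J≤n)) (FP.toℕ-fromℕ< (s≤s K≤n))
           (atFin (fromℕ< (s≤s J≤n)) (fromℕ< (s≤s K≤n)))
    where
    atFin : ∀ j k → cornerNW B (toℕ j) (toℕ k) ≤ cornerNW A (toℕ j) (toℕ k)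
    atFin j k = +-cancelʳ-≤ (cornerSW B (toℕ j) (toℕ k)) _ _ (begin
      cornerNW B (toℕ j) (toℕ k) + cornerSW B (toℕ j) (toℕ k)
        ≡⟨ cornerNW+cornerSW pB (toℕ j) (toℕ k) (FP.toℕ≤pred[n] k) ⟩
      toℕ k
        ≡⟨ sym (trans (dist-rot-Id (opposite k) k) (trans (cong (toℕ k ⊓_) (n∸opposite k)) (⊓-idem (toℕ k)))) ⟩
      dist (rot Id) (opposite k) k
        ≡⟨ product (opposite k) k ⟩
      (dist (rot A) ⊙ dist B) (opposite k) k
        ≤⟨ minFin-≤ (λ j' → dist (rot A) (opposite k) j' + dist B j' k) j ⟩
      dist (rot A) (opposite k) j + dist B j k
        ≡⟨ dist-rot+dist (opposite k) j k ⟩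
      cornerNW A (toℕ j) (n ∸ toℕ (opposite k)) + cornerSW B (toℕ j) (toℕ k)
        ≡⟨ cong (λ m → cornerNW A (toℕ j) m + cornerSW B (toℕ j) (toℕ k)) (n∸opposite k) ⟩
      cornerNW A (toℕ j) (toℕ k) + cornerSW B (toℕ j) (toℕ k) ∎)
      where open ≤-Reasoning

  dominates⇒boxProduct : Dominates A B → IsBoxProd (rot A) B (rot Id)
  dominates⇒boxProduct dom = rot-Id-isPerm , λ i k → trans (dist-rot-Id i k) (sym (minimum i k))
    where
    minimum : ∀ i k → (dist (rot A) ⊙ dist B) i k ≡ toℕ k ⊓ (n ∸ toℕ i)
    minimum i k = ≤-antisym (⊓-glb (≤-trans (minFin-≤ f F.zero) (≤-reflexive atZero))
                                   (≤-trans (minFin-≤ f (fromℕ n)) (≤-reflexive atFull)))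
                            (minFin-glb f (K ⊓ m) lower)
      where
      K m : ℕ
      K = toℕ k
      m = n ∸ toℕ i
      K≤n : K ≤ n
      K≤n = FP.toℕ≤pred[n] k
      m≤n : m ≤ n
      m≤n = m∸n≤m n (toℕ i)
      f : Fin (suc n) → ℕ
      f j = dist (rot A) i j + dist B j k
      atZero : f F.zero ≡ K
      atZero = trans (dist-rot+dist i F.zero k) (cong₂ _+_ (cornerNW-zero A m) (cornerSW-zero pB K K≤n))
      atFull : f (fromℕ n) ≡ m
      atFull = trans (dist-rot+dist i (fromℕ n) k)
                     (trans (cong (λ J → cornerNW A J m + cornerSW B J K) (FP.toℕ-fromℕ n))
                            (trans (cong₂ _+_ (cornerNW-full pA m m≤n) (cornerSW-full B K)) (+-identityʳ m)))
      lower : ∀ j → K ⊓ m ≤ f j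
      lower j = begin
        K ⊓ m                                       ≡⟨ sym (cornerNW+cornerSW pB J (K ⊓ m) L≤n) ⟩
        cornerNW B J (K ⊓ m) + cornerSW B J (K ⊓ m) ≤⟨ +-mono-≤ NW≤ (cornerSW-monoʳ B J (m⊓n≤m K m)) ⟩
        cornerNW A J m + cornerSW B J K             ≡⟨ sym (dist-rot+dist i j k) ⟩
        f j                                         ∎
        where
        open ≤-Reasoning
        J : ℕ
        J = toℕ j
        L≤n : K ⊓ m ≤ n
        L≤n = ≤-trans (m⊓n≤n K m) m≤n
        NW≤ : cornerNW B J (K ⊓ m) ≤ cornerNW A J m
        NW≤ = ≤-trans (dom J (K ⊓ m) (FP.toℕ≤pred[n] j) L≤n) (cornerNW-monoʳ A J (m⊓n≤n K m))

-- Bruhat steps decrease corner counts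

_+ᴹ_ : ∀ {n} → Mat n → Mat n → Mat n
(F +ᴹ G) l c = F l c + G l c

matrixUnit : ∀ {n} → Fin n → Fin n → Mat n
matrixUnit p q l c = Id p l * Id q c

inCorner : ∀ {n} → Fin n → Fin n → ℕ → ℕ → ℕ
inCorner p q J K = ⟦ toℕ p < J ⟧ * ⟦ toℕ q < K ⟧

cornerNW-cong : ∀ {n} {F G : Mat n} → (∀ l c → F l c ≡ G l c) → ∀ J K → cornerNW F J K ≡ cornerNW G J K
cornerNW-cong F≗G J K =
  sumFin-cong (λ l → cong (⟦ toℕ l < J ⟧ *_) (sumFin-cong (λ c → cong (⟦ toℕ c < K ⟧ *_) (F≗G l c))))

rowCount-+ᴹ : ∀ {n} (F G : Mat n) l K → rowCount (F +ᴹ G) l K ≡ rowCount F l K + rowCount G l K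
rowCount-+ᴹ F G l K = trans (sumFin-cong (λ c → *-distribˡ-+ ⟦ toℕ c < K ⟧ (F l c) (G l c)))
                            (sumFin-+ (λ c → ⟦ toℕ c < K ⟧ * F l c) (λ c → ⟦ toℕ c < K ⟧ * G l c))

cornerNW-+ᴹ : ∀ {n} (F G : Mat n) J K → cornerNW (F +ᴹ G) J K ≡ cornerNW F J K + cornerNW G J K
cornerNW-+ᴹ F G J K =
  trans (sumFin-cong (λ l → trans (cong (⟦ toℕ l < J ⟧ *_) (rowCount-+ᴹ F G l K))
                                  (*-distribˡ-+ ⟦ toℕ l < J ⟧ (rowCount F l K) (rowCount G l K))))
        (sumFin-+ (λ l → ⟦ toℕ l < J ⟧ * rowCount F l K) (λ l → ⟦ toℕ l < J ⟧ * rowCount G l K))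

cornerNW-matrixUnit : ∀ {n} (p q : Fin n) J K → cornerNW (matrixUnit p q) J K ≡ inCorner p q J K
cornerNW-matrixUnit p q J K =
  trans (sumFin-cong (λ l → trans (cong (⟦ toℕ l < J ⟧ *_) (row l)) (sym (*-assoc ⟦ toℕ l < J ⟧ _ _))))
        (sumFin-*-Id p (λ l → inCorner l q J K))
  where
  row : ∀ l → rowCount (matrixUnit p q) l K ≡ ⟦ toℕ q < K ⟧ * Id p l
  row l = begin
    sumFin (λ c → ⟦ toℕ c < K ⟧ * (Id p l * Id q c))
      ≡⟨ sumFin-cong (λ c → x∙yz≈y∙xz ⟦ toℕ c < K ⟧ (Id p l) (Id q c)) ⟩
    sumFin (λ c → Id p l * (⟦ toℕ c < K ⟧ * Id q c))
      ≡⟨ sumFin-*ˡ (Id p l) (λ c → ⟦ toℕ c < K ⟧ * Id q c) ⟩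
    Id p l * sumFin (λ c → ⟦ toℕ c < K ⟧ * Id q c)
      ≡⟨ cong (Id p l *_) (sumFin-*-Id q (λ c → ⟦ toℕ c < K ⟧)) ⟩
    Id p l * ⟦ toℕ q < K ⟧
      ≡⟨ *-comm (Id p l) _ ⟩
    ⟦ toℕ q < K ⟧ * Id p l ∎
    where open ≡-Reasoning

cornerNW-+pair : ∀ {n} (F : Mat n) p q p' q' J K →
  cornerNW (F +ᴹ (matrixUnit p q +ᴹ matrixUnit p' q')) J K ≡ cornerNW F J K + (inCorner p q J K + inCorner p' q' J K)
cornerNW-+pair F p q p' q' J K =
  trans (cornerNW-+ᴹ F _ J K)
        (cong (cornerNW F J K +_) (trans (cornerNW-+ᴹ (matrixUnit p q) (matrixUnit p' q') J K)
                                         (cong₂ _+_ (cornerNW-matrixUnit p q J K) (cornerNW-matrixUnit p' q' J K))))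

unitPair-onRow : ∀ {n} {p p' l : Fin n} (q q' : Fin n) → p ≡ l → p' ≢ l →
                 ∀ c → (matrixUnit p q +ᴹ matrixUnit p' q') l c ≡ Id q c
unitPair-onRow q q' p≡l p'≢l c =
  trans (cong₂ _+_ (cong (_* Id q c) (Id-≡ p≡l)) (cong (_* Id q' c) (Id-≢ p'≢l)))
        (trans (+-identityʳ (1 * Id q c)) (*-identityˡ (Id q c)))

unitPair-onRowʳ : ∀ {n} {p p' l : Fin n} (q q' : Fin n) → p ≢ l → p' ≡ l →
                  ∀ c → (matrixUnit p q +ᴹ matrixUnit p' q') l c ≡ Id q' c
unitPair-onRowʳ {p = p} {p'} {l} q q' p≢l p'≡l c =
  trans (+-comm (matrixUnit p q l c) (matrixUnit p' q' l c)) (unitPair-onRow q' q p'≡l p≢l c)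

unitPair-offRows : ∀ {n} {p p' l : Fin n} (q q' : Fin n) → p ≢ l → p' ≢ l →
                   ∀ c → (matrixUnit p q +ᴹ matrixUnit p' q') l c ≡ 0
unitPair-offRows q q' p≢l p'≢l c = cong₂ _+_ (cong (_* Id q c) (Id-≢ p≢l)) (cong (_* Id q' c) (Id-≢ p'≢l))

rowExchange : ∀ {n} {x y : Fin n → ℕ} {p q : Fin n} → p ≢ q →
  x p ≡ 1 → x q ≡ 0 → y p ≡ 0 → y q ≡ 1 → (∀ c → c ≢ p → c ≢ q → y c ≡ x c) →
  ∀ c → y c + Id p c ≡ x c + Id q c
rowExchange {x = x} {y} {p} {q} p≢q xp≡1 xq≡0 yp≡0 yq≡1 y≗x c = by (p ≟ c) (q ≟ c)
  where
  by : Dec (p ≡ c) → Dec (q ≡ c) → y c + Id p c ≡ x c + Id q c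
  by (yes refl) _          = trans (cong₂ _+_ yp≡0 (Id-≡ refl)) (sym (cong₂ _+_ xp≡1 (Id-≢ (p≢q ∘ sym))))
  by (no _)     (yes refl) = trans (cong₂ _+_ yq≡1 (Id-≢ p≢q)) (sym (cong₂ _+_ xq≡0 (Id-≡ refl)))
  by (no p≢c)   (no q≢c)   = cong₂ _+_ (y≗x c (p≢c ∘ sym) (q≢c ∘ sym)) (trans (Id-≢ p≢c) (sym (Id-≢ q≢c)))

<⇒≢ᶠ : ∀ {n} {a b : Fin n} → toℕ a < toℕ b → a ≢ b
<⇒≢ᶠ a<b a≡b = <-irrefl (cong toℕ a≡b) a<b

step-exchange : ∀ {n} {A C : Mat n} (s : Step A C) → let (i , i' , j , j' , _) = s in
  ∀ l c → (C +ᴹ (matrixUnit i j +ᴹ matrixUnit i' j')) l c ≡ (A +ᴹ (matrixUnit i j' +ᴹ matrixUnit i' j)) l c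
step-exchange {A = A} {C} (i , i' , j , j' , i<i' , j<j' , a₁ , a₂ , a₃ , a₄ , c₁ , c₂ , c₃ , c₄ , frame) l c =
  by (i ≟ l) (i' ≟ l)
  where
  j≢j' : j ≢ j'
  j≢j' = <⇒≢ᶠ j<j'
  i'≢i : i' ≢ i
  i'≢i = <⇒≢ᶠ i<i' ∘ sym
  frameColumns : ∀ k c → c ≢ j → c ≢ j' → C k c ≡ A k c
  frameColumns k c c≢j c≢j' = frame k c λ where
    (_ , inj₁ c≡j)  → c≢j c≡j
    (_ , inj₂ c≡j') → c≢j' c≡j'
  by : Dec (i ≡ l) → Dec (i' ≡ l) →
       C l c + (matrixUnit i j +ᴹ matrixUnit i' j') l c ≡ A l c + (matrixUnit i j' +ᴹ matrixUnit i' j) l c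
  by (yes refl) _ =
    trans (cong (C i c +_) (unitPair-onRow j j' refl i'≢i c))
          (trans (rowExchange j≢j' a₁ a₂ c₁ c₂ (frameColumns i) c)
                 (cong (A i c +_) (sym (unitPair-onRow j' j refl i'≢i c))))
  by (no i≢l) (yes refl) =
    trans (cong (C i' c +_) (unitPair-onRowʳ j j' i≢l refl c))
          (trans (rowExchange (j≢j' ∘ sym) a₄ a₃ c₄ c₃ (λ c c≢j' c≢j → frameColumns i' c c≢j c≢j') c)
                 (cong (A i' c +_) (sym (unitPair-onRowʳ j' j i≢l refl c))))
  by (no i≢l) (no i'≢l) =
    cong₂ _+_ (frame l c λ { (inj₁ l≡i , _) → i≢l (sym l≡i) ; (inj₂ l≡i' , _) → i'≢l (sym l≡i') })
              (trans (unitPair-offRows j j' i≢l i'≢l c) (sym (unitPair-offRows j' j i≢l i'≢l c)))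

cornerNW-step : ∀ {n} {A C : Mat n} (s : Step A C) → let (i , i' , j , j' , _) = s in
  ∀ J K → cornerNW C J K + (inCorner i j J K + inCorner i' j' J K)
        ≡ cornerNW A J K + (inCorner i j' J K + inCorner i' j J K)
cornerNW-step {A = A} {C} s@(i , i' , j , j' , _) J K = begin
  cornerNW C J K + (inCorner i j J K + inCorner i' j' J K)   ≡⟨ sym (cornerNW-+pair C i j i' j' J K) ⟩
  cornerNW (C +ᴹ (matrixUnit i j +ᴹ matrixUnit i' j')) J K   ≡⟨ cornerNW-cong (step-exchange s) J K ⟩
  cornerNW (A +ᴹ (matrixUnit i j' +ᴹ matrixUnit i' j)) J K   ≡⟨ cornerNW-+pair A i j' i' j J K ⟩
  cornerNW A J K + (inCorner i j' J K + inCorner i' j J K)   ∎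
  where open ≡-Reasoning

rearrangement : ∀ {a b x y} → b ≤ a → y ≤ x → a * y + b * x ≤ a * x + b * y
rearrangement {a} {b} {x} {y} b≤a y≤x rewrite sym (m+[n∸m]≡n b≤a) | sym (m+[n∸m]≡n y≤x) =
  subst ((b + (a ∸ b)) * y + b * (y + (x ∸ y)) ≤_) (expand b (a ∸ b) y (x ∸ y)) (m≤m+n _ _)
  where
  expand : ∀ b d y e → (b + d) * y + b * (y + e) + d * e ≡ (b + d) * (y + e) + b * y
  expand = solve-∀

cornerNW-step-≤ : ∀ {n} {A C : Mat n} → Step A C → ∀ J K → cornerNW C J K ≤ cornerNW A J K
cornerNW-step-≤ {A = A} {C} s@(i , i' , j , j' , i<i' , j<j' , _) J K =
  +-cancelʳ-≤ (inCorner i j J K + inCorner i' j' J K) (cornerNW C J K) (cornerNW A J K) (begin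
    cornerNW C J K + (inCorner i j J K + inCorner i' j' J K)
      ≡⟨ cornerNW-step s J K ⟩
    cornerNW A J K + (inCorner i j' J K + inCorner i' j J K)
      ≤⟨ +-monoʳ-≤ (cornerNW A J K) (rearrangement (⟦<⟧-antiˡ J i<i') (⟦<⟧-antiˡ K j<j')) ⟩
    cornerNW A J K + (inCorner i j J K + inCorner i' j' J K) ∎)
  where open ≤-Reasoning

bruhat⇒dominates : ∀ {n} {A B : Mat n} → BruhatBelow A B → Dominates A B
bruhat⇒dominates (done A≗B)   J K _   _   = ≤-reflexive (cornerNW-cong (λ l c → sym (A≗B l c)) J K)
bruhat⇒dominates (step s A↝B) J K J≤n K≤n = ≤-trans (bruhat⇒dominates A↝B J K J≤n K≤n) (cornerNW-step-≤ s J K)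

-- Dominance allows a step towards B

cornerCount : ∀ {n} → (Fin n → Fin n) → ℕ → ℕ → ℕ
cornerCount σ J K = sumFin (λ l → ⟦ toℕ l < J ⟧ * ⟦ toℕ (σ l) < K ⟧)

cornerNW≡cornerCount : ∀ {n} {A : Mat n} (pA : PermutationMatrix A) → ∀ J K →
                       cornerNW A J K ≡ cornerCount (PermutationMatrix.σ pA) J K
cornerNW≡cornerCount {A = A} pA J K =
  sumFin-cong (λ l → cong (⟦ toℕ l < J ⟧ *_) (rowCount-Id A l (σ l) (row l) K))
  where open PermutationMatrix pA

cornerCount-+ : ∀ {n} (σ τ : Fin n → Fin n) J K K' →
  cornerCount σ J K + cornerCount τ J K'
    ≡ sumFin (λ l → ⟦ toℕ l < J ⟧ * (⟦ toℕ (σ l) < K ⟧ + ⟦ toℕ (τ l) < K' ⟧))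
cornerCount-+ σ τ J K K' =
  trans (sym (sumFin-+ (λ l → ⟦ toℕ l < J ⟧ * ⟦ toℕ (σ l) < K ⟧)
                       (λ l → ⟦ toℕ l < J ⟧ * ⟦ toℕ (τ l) < K' ⟧)))
        (sumFin-cong (λ l → sym (*-distribˡ-+ ⟦ toℕ l < J ⟧ ⟦ toℕ (σ l) < K ⟧ ⟦ toℕ (τ l) < K' ⟧)))

⟦<⟧*-mono : ∀ a J {x y} → (a < J → x ≤ y) → ⟦ a < J ⟧ * x ≤ ⟦ a < J ⟧ * y
⟦<⟧*-mono a J {x} {y} x≤y = by (a <? J)
  where
  by : (d : Dec (a < J)) → 𝟙 d * x ≤ 𝟙 d * y
  by (yes a<J) = *-monoʳ-≤ 1 (x≤y a<J)
  by (no _)    = z≤n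

⟦<⟧*-mono-< : ∀ {a J x y} → a < J → x < y → ⟦ a < J ⟧ * x < ⟦ a < J ⟧ * y
⟦<⟧*-mono-< {a} {J} {x} {y} a<J x<y =
  subst (λ t → t * x < t * y) (sym (⟦<⟧-yes a<J)) (subst₂ _<_ (sym (*-identityˡ x)) (sym (*-identityˡ y)) x<y)

firstDifference-< : ∀ {n} (σ τ : Fin n → Fin n) (i : Fin n) →
  (∀ l → toℕ l < toℕ i → σ l ≡ τ l) → σ i ≢ τ i →
  cornerCount τ (suc (toℕ i)) (suc (toℕ (τ i))) ≤ cornerCount σ (suc (toℕ i)) (suc (toℕ (τ i))) →
  toℕ (σ i) < toℕ (τ i)
firstDifference-< σ τ i agree differ τ≤σ with <-cmp (toℕ (σ i)) (toℕ (τ i))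
... | tri< σi<τi _ _ = σi<τi
... | tri≈ _ σi≡τi _ = ⊥-elim (differ (FP.toℕ-injective σi≡τi))
... | tri> _ _ τi<σi = ⊥-elim (<⇒≱ (sumFin-mono-< row i atI) τ≤σ)
  where
  J K : ℕ
  J = suc (toℕ i)
  K = suc (toℕ (τ i))
  σi≮K : ¬ toℕ (σ i) < K
  σi≮K σi<K = <⇒≱ τi<σi (≤-pred σi<K)
  compare : ∀ l → toℕ l ≤ toℕ i → ⟦ toℕ (σ l) < K ⟧ ≤ ⟦ toℕ (τ l) < K ⟧
  compare l l≤i with m≤n⇒m<n∨m≡n l≤i
  ... | inj₁ l<i = ≤-reflexive (cong (λ x → ⟦ toℕ x < K ⟧) (agree l l<i))
  ... | inj₂ l≡i rewrite FP.toℕ-injective l≡i = subst (_≤ ⟦ toℕ (τ i) < K ⟧) (sym (⟦<⟧-no σi≮K)) z≤n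
  row : ∀ l → ⟦ toℕ l < J ⟧ * ⟦ toℕ (σ l) < K ⟧ ≤ ⟦ toℕ l < J ⟧ * ⟦ toℕ (τ l) < K ⟧
  row l = ⟦<⟧*-mono (toℕ l) J (λ l<J → compare l (≤-pred l<J))
  atI : ⟦ toℕ i < J ⟧ * ⟦ toℕ (σ i) < K ⟧ < ⟦ toℕ i < J ⟧ * ⟦ toℕ (τ i) < K ⟧
  atI = ⟦<⟧*-mono-< {toℕ i} {J} ≤-refl
          (subst₂ _<_ (sym (⟦<⟧-no σi≮K)) (sym (⟦<⟧-yes {toℕ (τ i)} {K} ≤-refl)) ≤-refl)

-- Among the rows l < J, those with σ l in columns K … τ i all precede i, where σ agrees with τ, while
-- τ i lies there too; removing these columns from the dominance at column τ i + 1 gives the claim.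
exchange-cornerCount-< : ∀ {n} (σ τ : Fin n → Fin n) (i : Fin n) {J K} →
  (∀ l → toℕ l < toℕ i → σ l ≡ τ l) → toℕ i < J → toℕ (σ i) < K → K ≤ toℕ (τ i) →
  (∀ l → toℕ i < toℕ l → toℕ l < J → ¬ (toℕ (σ i) < toℕ (σ l) × toℕ (σ l) ≤ toℕ (τ i))) →
  cornerCount τ J (suc (toℕ (τ i))) ≤ cornerCount σ J (suc (toℕ (τ i))) →
  cornerCount τ J K < cornerCount σ J K
exchange-cornerCount-< σ τ i {J} {K} agree i<J σi<K K≤τi clear τ≤σ =
  +-cancelˡ-< (cornerCount σ J K') (cornerCount τ J K) (cornerCount σ J K) (begin-strict
    cornerCount σ J K' + cornerCount τ J K
      ≡⟨ cornerCount-+ σ τ J K' K ⟩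
    sumFin (λ l → ⟦ toℕ l < J ⟧ * (⟦ toℕ (σ l) < K' ⟧ + ⟦ toℕ (τ l) < K ⟧))
      <⟨ sumFin-mono-< (λ l → ⟦<⟧*-mono (toℕ l) J (band l)) i (⟦<⟧*-mono-< i<J bandAtI) ⟩
    sumFin (λ l → ⟦ toℕ l < J ⟧ * (⟦ toℕ (σ l) < K ⟧ + ⟦ toℕ (τ l) < K' ⟧))
      ≡⟨ sym (cornerCount-+ σ τ J K K') ⟩
    cornerCount σ J K + cornerCount τ J K'
      ≤⟨ +-monoʳ-≤ (cornerCount σ J K) τ≤σ ⟩
    cornerCount σ J K + cornerCount σ J K'
      ≡⟨ +-comm (cornerCount σ J K) _ ⟩
    cornerCount σ J K' + cornerCount σ J K ∎)
  where
  open ≤-Reasoning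
  K' : ℕ
  K' = suc (toℕ (τ i))
  K≤K' : K ≤ K'
  K≤K' = ≤-trans K≤τi (n≤1+n _)
  bandAtI : ⟦ toℕ (σ i) < K' ⟧ + ⟦ toℕ (τ i) < K ⟧ < ⟦ toℕ (σ i) < K ⟧ + ⟦ toℕ (τ i) < K' ⟧
  bandAtI = subst₂ _<_ (sym (cong₂ _+_ (⟦<⟧-yes (<-≤-trans σi<K K≤K')) (⟦<⟧-no (≤⇒≯ K≤τi))))
                       (sym (cong₂ _+_ (⟦<⟧-yes σi<K) (⟦<⟧-yes ≤-refl))) ≤-refl
  σ-skipsBand : ∀ l → toℕ i < toℕ l → toℕ l < J → ⟦ toℕ (σ l) < K' ⟧ ≡ ⟦ toℕ (σ l) < K ⟧
  σ-skipsBand l i<l l<J =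
    𝟙-cong (toℕ (σ l) <? K') (toℕ (σ l) <? K) (below (toℕ (σ l) <? K)) (λ σl<K → <-≤-trans σl<K K≤K')
    where
    below : Dec (toℕ (σ l) < K) → toℕ (σ l) < K' → toℕ (σ l) < K
    below (yes σl<K) _   = σl<K
    below (no σl≮K)  σl<K' = ⊥-elim (clear l i<l l<J (<-≤-trans σi<K (≮⇒≥ σl≮K) , ≤-pred σl<K'))
  band : ∀ l → toℕ l < J →
         ⟦ toℕ (σ l) < K' ⟧ + ⟦ toℕ (τ l) < K ⟧ ≤ ⟦ toℕ (σ l) < K ⟧ + ⟦ toℕ (τ l) < K' ⟧
  band l l<J with <-cmp (toℕ l) (toℕ i)
  ... | tri< l<i _ _ rewrite agree l l<i = ≤-reflexive (+-comm ⟦ toℕ (τ l) < K' ⟧ _)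
  ... | tri≈ _ l≡i _ rewrite FP.toℕ-injective l≡i = <⇒≤ bandAtI
  ... | tri> _ _ i<l = +-mono-≤ (≤-reflexive (σ-skipsBand l i<l l<J)) (⟦<⟧-monoʳ (toℕ (τ l)) K≤K')

transpose-matchˡ : ∀ {n} (i j : Fin n) → transpose i j i ≡ j
transpose-matchˡ i j rewrite dec-true (i ≟ i) refl = refl

transpose-matchʳ : ∀ {n} (i j : Fin n) → transpose i j j ≡ i
transpose-matchʳ i j with j ≟ i
... | yes j≡i = j≡i
... | no _ rewrite dec-true (j ≟ j) refl = refl

transpose-other : ∀ {n} {i j k : Fin n} → k ≢ i → k ≢ j → transpose i j k ≡ k
transpose-other {i = i} {j} {k} k≢i k≢j rewrite dec-false (k ≟ i) k≢i | dec-false (k ≟ j) k≢j = refl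

swapRows : ∀ {n} → Mat n → Fin n → Fin n → Mat n
swapRows A i i' l c = A (transpose i i' l) c

module _ {n : ℕ} {A : Mat n} (pA : PermutationMatrix A) where
  open PermutationMatrix pA

  swapRows-permutationMatrix : ∀ i i' → PermutationMatrix (swapRows A i i')
  swapRows-permutationMatrix i i' = record
    { σ   = σ ∘ transpose i i'
    ; τ   = transpose i' i ∘ τ
    ; row = λ l → row (transpose i i' l)
    ; col = λ r c → trans (col (transpose i i' r) c)
                          (Id-inverse (transpose i i') (transpose i' i)
                                      (λ _ → transpose-inverse i i') (λ _ → transpose-inverse i' i) (τ c) r)
    }

  swapRows-step : ∀ {i i'} → toℕ i < toℕ i' → toℕ (σ i) < toℕ (σ i') → Step A (swapRows A i i')
  swapRows-step {i} {i'} i<i' σi<σi' =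
    i , i' , σ i , σ i' , i<i' , σi<σi' ,
    trans (row i (σ i)) (Id-≡ refl) , trans (row i (σ i')) (Id-≢ σi≢σi') ,
    trans (row i' (σ i)) (Id-≢ (σi≢σi' ∘ sym)) , trans (row i' (σ i')) (Id-≡ refl) ,
    trans (rowI (σ i)) (trans (row i' (σ i)) (Id-≢ (σi≢σi' ∘ sym))) ,
    trans (rowI (σ i')) (trans (row i' (σ i')) (Id-≡ refl)) ,
    trans (rowI' (σ i)) (trans (row i (σ i)) (Id-≡ refl)) ,
    trans (rowI' (σ i')) (trans (row i (σ i')) (Id-≢ σi≢σi')) ,
    frame
    where
    σi≢σi' : σ i ≢ σ i'
    σi≢σi' = <⇒≢ᶠ σi<σi'
    rowI : ∀ c → swapRows A i i' i c ≡ A i' c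
    rowI c = cong (λ r → A r c) (transpose-matchˡ i i')
    rowI' : ∀ c → swapRows A i i' i' c ≡ A i c
    rowI' c = cong (λ r → A r c) (transpose-matchʳ i i')
    frame : ∀ k c → ¬ ((k ≡ i ⊎ k ≡ i') × (c ≡ σ i ⊎ c ≡ σ i')) → swapRows A i i' k c ≡ A k c
    frame k c outside = by (k ≟ i) (k ≟ i')
      where
      by : Dec (k ≡ i) → Dec (k ≡ i') → A (transpose i i' k) c ≡ A k c
      by (yes refl) _ =
        trans (rowI c)
              (trans (row i' c) (trans (Id-≢ (λ e → outside (inj₁ refl , inj₂ (sym e))))
                                       (sym (trans (row i c) (Id-≢ (λ e → outside (inj₁ refl , inj₁ (sym e))))))))
      by (no _) (yes refl) =
        trans (rowI' c)
              (trans (row i c) (trans (Id-≢ (λ e → outside (inj₂ refl , inj₁ (sym e))))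
                                      (sym (trans (row i' c) (Id-≢ (λ e → outside (inj₂ refl , inj₂ (sym e))))))))
      by (no k≢i) (no k≢i') = cong (λ r → A r c) (transpose-other k≢i k≢i')

inCorner-exchange-inside : ∀ {n} {a a' b b' : Fin n} {J K} →
  toℕ a < J → J ≤ toℕ a' → toℕ b < K → K ≤ toℕ b' →
  inCorner a b J K + inCorner a' b' J K ≡ suc (inCorner a b' J K + inCorner a' b J K)
inCorner-exchange-inside a<J J≤a' b<K K≤b' =
  values (⟦<⟧-yes a<J) (⟦<⟧-no (≤⇒≯ J≤a')) (⟦<⟧-yes b<K) (⟦<⟧-no (≤⇒≯ K≤b'))
  where
  values : ∀ {x₁ x₂ y₁ y₂} → x₁ ≡ 1 → x₂ ≡ 0 → y₁ ≡ 1 → y₂ ≡ 0 →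
           x₁ * y₁ + x₂ * y₂ ≡ suc (x₁ * y₂ + x₂ * y₁)
  values refl refl refl refl = refl

⟦<⟧-outside : ∀ {a a' J} → a < a' → ¬ (a < J × J ≤ a') → ⟦ a < J ⟧ ≡ ⟦ a' < J ⟧
⟦<⟧-outside {a} {a'} {J} a<a' outside =
  𝟙-cong (a <? J) (a' <? J) (λ a<J → ≰⇒> (λ J≤a' → outside (a<J , J≤a'))) (<-trans a<a')

inCorner-exchange-outside : ∀ {n} {a a' b b' : Fin n} {J K} → toℕ a < toℕ a' → toℕ b < toℕ b' →
  ¬ (toℕ a < J × J ≤ toℕ a') ⊎ ¬ (toℕ b < K × K ≤ toℕ b') →
  inCorner a b J K + inCorner a' b' J K ≡ inCorner a b' J K + inCorner a' b J K
inCorner-exchange-outside a<a' b<b' outside = values (map⊎ (⟦<⟧-outside a<a') (⟦<⟧-outside b<b') outside)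
  where
  values : ∀ {x₁ x₂ y₁ y₂} → x₁ ≡ x₂ ⊎ y₁ ≡ y₂ → x₁ * y₁ + x₂ * y₂ ≡ x₁ * y₂ + x₂ * y₁
  values {x₁} {y₁ = y₁} {y₂} (inj₁ refl) = +-comm (x₁ * y₁) (x₁ * y₂)
  values                     (inj₂ refl) = refl

Minimal : ∀ {n} → (Fin n → Set) → Fin n → Set
Minimal P i = P i × (∀ l → toℕ l < toℕ i → ¬ P l)

minimal? : ∀ {n} (P : Fin n → Set) → (∀ l → Dec (P l)) → (∀ l → ¬ P l) ⊎ Σ (Fin n) (Minimal P)
minimal? {zero}  P P? = inj₁ (λ ())
minimal? {suc n} P P? with P? F.zero
... | yes p₀ = inj₂ (F.zero , p₀ , λ _ ())
... | no ¬p₀ with minimal? (P ∘ F.suc) (P? ∘ F.suc)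
...   | inj₁ none = inj₁ λ { F.zero → ¬p₀ ; (F.suc l) → none l }
...   | inj₂ (i , pᵢ , below) =
        inj₂ (F.suc i , pᵢ , λ { F.zero _ → ¬p₀ ; (F.suc l) l<i → below l (≤-pred l<i) })

minimal : ∀ {n} (P : Fin n → Set) → (∀ l → Dec (P l)) → ∀ r → P r → Σ (Fin n) (Minimal P)
minimal P P? r pᵣ with minimal? P P?
... | inj₁ none = ⊥-elim (none r pᵣ)
... | inj₂ m    = m

cornerTotal : ∀ {n} → Mat n → ℕ
cornerTotal {n} A = sumFin {suc n} (λ J → sumFin {suc n} (λ K → cornerNW A (toℕ J) (toℕ K)))

record Exchange {n : ℕ} (A B : Mat n) : Set where
  field
    {C}       : Mat n
    oneStep   : Step A C
    permC     : PermutationMatrix C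
    dominates : Dominates C B
    decreases : cornerTotal C < cornerTotal A

module _ {n : ℕ} {A B : Mat n} (pA : PermutationMatrix A) (pB : PermutationMatrix B) (dom : Dominates A B) where
  open PermutationMatrix pA using () renaming (σ to σA; τ to τA; row to rowA; σ-τ to σA-τA)
  open PermutationMatrix pB using () renaming (σ to σB; row to rowB; σ-injective to σB-injective)

  dominatesCount : ∀ J K → J ≤ n → K ≤ n → cornerCount σB J K ≤ cornerCount σA J K
  dominatesCount J K J≤n K≤n =
    subst₂ _≤_ (cornerNW≡cornerCount pB J K) (cornerNW≡cornerCount pA J K) (dom J K J≤n K≤n)

  module AtFirstDifference (i : Fin n) (agree : ∀ l → toℕ l < toℕ i → σA l ≡ σB l) (differ : σA i ≢ σB i) where

    σAi<σBi : toℕ (σA i) < toℕ (σB i)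
    σAi<σBi = firstDifference-< σA σB i agree differ (dominatesCount _ _ (FP.toℕ<n i) (FP.toℕ<n (σB i)))

    Between : Fin n → Set
    Between l = toℕ i < toℕ l × toℕ (σA i) < toℕ (σA l) × toℕ (σA l) ≤ toℕ (σB i)

    between? : ∀ l → Dec (Between l)
    between? l = (toℕ i <? toℕ l) ×-dec ((toℕ (σA i) <? toℕ (σA l)) ×-dec (toℕ (σA l) ≤? toℕ (σB i)))

    target-between : Between (τA (σB i))
    target-between = below , subst (λ c → toℕ (σA i) < toℕ c) (sym hits) σAi<σBi , ≤-reflexive (cong toℕ hits)
      where
      hits : σA (τA (σB i)) ≡ σB i
      hits = σA-τA (σB i)
      below : toℕ i < toℕ (τA (σB i))
      below with <-cmp (toℕ (τA (σB i))) (toℕ i)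
      ... | tri< r<i _ _ = ⊥-elim (<⇒≢ᶠ r<i (σB-injective _ i (trans (sym (agree _ r<i)) hits)))
      ... | tri≈ _ r≡i _ = ⊥-elim (differ (trans (cong σA (sym (FP.toℕ-injective r≡i))) hits))
      ... | tri> _ _ i<r = i<r

    closest : Σ (Fin n) (Minimal Between)
    closest = minimal Between between? (τA (σB i)) target-between

    i' : Fin n
    i' = proj₁ closest

    i'-between : Between i'
    i'-between = proj₁ (proj₂ closest)

    i'-minimal : ∀ l → toℕ l < toℕ i' → ¬ Between l
    i'-minimal = proj₂ (proj₂ closest)

    i<i' : toℕ i < toℕ i'
    i<i' = proj₁ i'-between

    σAi<σAi' : toℕ (σA i) < toℕ (σA i')
    σAi<σAi' = proj₁ (proj₂ i'-between)

    C : Mat n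
    C = swapRows A i i'

    A→C : Step A C
    A→C = swapRows-step pA i<i' σAi<σAi'

    InRectangle : ℕ → ℕ → Set
    InRectangle J K = (toℕ i < J × J ≤ toℕ i') × (toℕ (σA i) < K × K ≤ toℕ (σA i'))

    cornerNW-inside : ∀ {J K} → InRectangle J K → suc (cornerNW C J K) ≡ cornerNW A J K
    cornerNW-inside {J} {K} ((i<J , J≤i') , (j<K , K≤j')) = +-cancelʳ-≡ _ (suc (cornerNW C J K)) (cornerNW A J K) (begin
      suc (cornerNW C J K) + (inCorner i (σA i') J K + inCorner i' (σA i) J K)
        ≡⟨ sym (+-suc (cornerNW C J K) _) ⟩
      cornerNW C J K + suc (inCorner i (σA i') J K + inCorner i' (σA i) J K)
        ≡⟨ cong (cornerNW C J K +_) (sym (inCorner-exchange-inside i<J J≤i' j<K K≤j')) ⟩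
      cornerNW C J K + (inCorner i (σA i) J K + inCorner i' (σA i') J K)
        ≡⟨ cornerNW-step A→C J K ⟩
      cornerNW A J K + (inCorner i (σA i') J K + inCorner i' (σA i) J K) ∎)
      where open ≡-Reasoning

    cornerNW-outside : ∀ {J K} → ¬ InRectangle J K → cornerNW C J K ≡ cornerNW A J K
    cornerNW-outside {J} {K} outside = +-cancelʳ-≡ _ (cornerNW C J K) (cornerNW A J K)
      (trans (cong (cornerNW C J K +_) (sym (inCorner-exchange-outside i<i' σAi<σAi' outside′))) (cornerNW-step A→C J K))
      where
      outside′ : ¬ (toℕ i < J × J ≤ toℕ i') ⊎ ¬ (toℕ (σA i) < K × K ≤ toℕ (σA i'))
      outside′ with (toℕ i <? J) ×-dec (J ≤? toℕ i')
      ... | no rows≠ = inj₁ rows≠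
      ... | yes rows = inj₂ (λ cols → outside (rows , cols))

    B<A-inside : ∀ {J K} → InRectangle J K → J ≤ n → cornerNW B J K < cornerNW A J K
    B<A-inside {J} {K} ((i<J , J≤i') , (j<K , K≤j')) J≤n =
      subst₂ _<_ (sym (cornerNW≡cornerCount pB J K)) (sym (cornerNW≡cornerCount pA J K))
        (exchange-cornerCount-< σA σB i agree i<J j<K (≤-trans K≤j' (proj₂ (proj₂ i'-between))) clear
                                (dominatesCount J _ J≤n (FP.toℕ<n (σB i))))
      where
      clear : ∀ l → toℕ i < toℕ l → toℕ l < J → ¬ (toℕ (σA i) < toℕ (σA l) × toℕ (σA l) ≤ toℕ (σB i))
      clear l i<l l<J band = i'-minimal l (<-≤-trans l<J J≤i') (i<l , band)

    C-dominates : Dominates C B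
    C-dominates J K J≤n K≤n
      with ((toℕ i <? J) ×-dec (J ≤? toℕ i')) ×-dec ((toℕ (σA i) <? K) ×-dec (K ≤? toℕ (σA i')))
    ... | yes inside  = ≤-pred (subst (cornerNW B J K <_) (sym (cornerNW-inside inside)) (B<A-inside inside J≤n))
    ... | no  outside = subst (cornerNW B J K ≤_) (sym (cornerNW-outside outside)) (dom J K J≤n K≤n)

    decreases : cornerTotal C < cornerTotal A
    decreases =
      sumFin-mono-< (λ J → sumFin-mono {suc n} (λ K → cornerNW-step-≤ A→C (toℕ J) (toℕ K))) (F.suc i)
        (sumFin-mono-< {suc n} (λ K → cornerNW-step-≤ A→C (suc (toℕ i)) (toℕ K)) (F.suc (σA i))
          (≤-reflexive (cornerNW-inside ((≤-refl , i<i') , (≤-refl , σAi<σAi')))))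

    exchange : Exchange A B
    exchange = record { oneStep = A→C ; permC = swapRows-permutationMatrix pA i i'
                      ; dominates = C-dominates ; decreases = decreases }

  equal-or-exchange : (∀ l c → A l c ≡ B l c) ⊎ Exchange A B
  equal-or-exchange with minimal? (λ l → σA l ≢ σB l) (λ l → ¬? (σA l ≟ σB l))
  ... | inj₁ noDifference =
        inj₁ (λ l c → trans (rowA l c) (trans (cong (λ p → Id p c) (agree l)) (sym (rowB l c))))
    where
    agree : ∀ l → σA l ≡ σB l
    agree l = decidable-stable (σA l ≟ σB l) (noDifference l)
  ... | inj₂ (i , differ , before) =
        inj₂ (AtFirstDifference.exchange i (λ l l<i → decidable-stable (σA l ≟ σB l) (before l l<i)) differ)

dominates⇒bruhat : ∀ {n} {A B : Mat n} → PermutationMatrix A → PermutationMatrix B → Dominates A B → BruhatBelow A B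
dominates⇒bruhat {A = A} {B} pA pB dom = descend (suc (cornerTotal A)) pA dom ≤-refl
  where
  descend : ∀ fuel {A} → PermutationMatrix A → Dominates A B → cornerTotal A < fuel → BruhatBelow A B
  descend zero       _  _   ()
  descend (suc fuel) pA dom bound with equal-or-exchange pA pB dom
  ... | inj₁ A≗B = done A≗B
  ... | inj₂ e   = step oneStep (descend fuel permC dominates (<-≤-trans decreases (≤-pred bound)))
    where open Exchange e

theorem2p20 : (n : ℕ) (PA PB : Mat n) → IsPerm PA → IsPerm PB →
    (BruhatBelow PA PB ⇔ IsBoxProd (rot PA) PB (rot Id))
theorem2p20 n PA PB isPermA isPermB = mk⇔
  (λ below → dominates⇒boxProduct pA pB (bruhat⇒dominates below))
  (λ product → dominates⇒bruhat pA pB (boxProduct⇒dominates pA pB product))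
  where
  pA : PermutationMatrix PA
  pA = isPerm⇒permutationMatrix isPermA
  pB : PermutationMatrix PB
  pB = isPerm⇒permutationMatrix isPermB
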